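{- Let $\ell\geq 2$ and $0\leq i\leq 2^{\ell-1}-2$ be integers. Then $v_2(A_{\ell,i})>2i+\ell-2^{\ell}$.
   Context: Define $a_\ell\in\mathbb{Z}[c]$ by $a_1=c$ and $a_{\ell+1}=a_\ell^2+c$, and write $a_\ell(c)=\sum_{i=0}^{2^{\ell-1}}A_{\ell,i}c^i$ with $A_{\ell,i}\in\mathbb{Z}$. $v_2$ is the $2$-adic valuation, with $v_2(0)=+\infty$. -}

module Defs where

open import Data.Nat using (ℕ; zero; suc; _^_)
open import Data.Integer using (ℤ; +_; _+_; _*_; _<_)
open import Data.Integer.Divisibility using (_∣_)
open import Data.List using (List; []; _∷_; map)
open import Data.Product using (∃; _×_)
open import Data.Sum using (_⊎_)
open import Relation.Nullary using (¬_)
open import Relation.Binary.PropositionalEquality using (_≡_)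

-- Polynomials in ℤ[c] as coefficient lists: p = p₀ ∷ p₁ ∷ …  means Σ pᵢ cⁱ.
Poly : Set
Poly = List ℤ

_⊕_ : Poly → Poly → Poly
[] ⊕ q = q
(x ∷ p) ⊕ [] = x ∷ p
(x ∷ p) ⊕ (y ∷ q) = (x + y) ∷ (p ⊕ q)

_⊗_ : Poly → Poly → Poly
[] ⊗ q = []
(x ∷ p) ⊗ q = map (x *_) q ⊕ (+ 0 ∷ (p ⊗ q))

cPoly : Poly
cPoly = + 0 ∷ + 1 ∷ []

-- a ℓ for ℓ ≥ 1, indexed by n = ℓ - 1 :  aₙ₊₁ with a₁ = c, a_{ℓ+1} = a_ℓ² + c
a′ : ℕ → Poly
a′ zero = cPoly
a′ (suc n) = (a′ n ⊗ a′ n) ⊕ cPoly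

-- a ℓ (with a 0 arbitrary = a 1; only ℓ ≥ 1 is ever used)
a : ℕ → Poly
a zero = cPoly
a (suc n) = a′ n

coeff : Poly → ℕ → ℤ
coeff [] _ = + 0
coeff (x ∷ p) zero = x
coeff (x ∷ p) (suc i) = coeff p i

A : ℕ → ℕ → ℤ
A ℓ i = coeff (a ℓ) i

-- v₂-gt x m means "v₂(x) > m" with v₂(0) = +∞ : either x = 0, or v₂(x) = n (2ⁿ ∣ x, 2ⁿ⁺¹ ∤ x) with m < n.
v₂-gt :  ℤ → ℤ → Set
v₂-gt x m = x ≡ + 0 ⊎ ∃ λ n → (+ (2 ^ n) ∣ x) × (¬ (+ (2 ^ suc n) ∣ x)) × (m < + n)

{-# OPTIONS --safe #-}
-- Let D = 2^(ℓ−1) = deg aℓ and b(ℓ, i) = 2i + ℓ + 1 − 2^ℓ. By induction on ℓ ≥ 2, v₂(A(ℓ, i)) ≥ b(ℓ, i)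
-- for every i, up to a deficit at the two top coefficients i = D − 1 and i = D. The coefficient of cᵏ
-- in aℓ² is a sum of squares A(ℓ, i)² with 2i = k and of cross terms 2 A(ℓ, i) A(ℓ, j) with i < j and
-- i + j = k; since 2 b(ℓ, i) = b(ℓ+1, 2i) + ℓ and b(ℓ, i) + b(ℓ, j) + 1 = b(ℓ+1, i + j) + ℓ + 1, the
-- surplus absorbs the deficits. The added c only affects k = 1, where b(ℓ+1, 1) ≤ 0.
module Submission where

module TwoAdicBounds where

  open import Defs
  open import Data.Nat as ℕ using (ℕ; zero; suc; _≤_; _<_; _∸_; _^_; _≟_; z≤n; s≤s)
  import Data.Nat.Properties as ℕP
  import Data.Nat.Divisibility as ℕ∣
  open import Data.Nat.Induction using (<-rec)
  open import Data.Nat.Tactic.RingSolver using (solve-∀)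
  open import Data.Integer as ℤ using (ℤ; +_; _+_; _*_; ∣_∣)
  import Data.Integer.Properties as ℤP
  open import Data.Integer.Divisibility.Signed
    using (_∣_; divides; ∣-refl; ∣m⇒∣m*n; ∣m∣n⇒∣m+n; *-monoˡ-∣; *-monoʳ-∣; *-cancelˡ-∣; ∣⇒∣ᵤ; module ∣-Reasoning)
  open import Algebra.Properties.CommutativeSemigroup ℤP.*-commutativeSemigroup using (interchange; xy∙z≈x∙zy)
  open import Algebra.Properties.CommutativeSemigroup ℤP.+-commutativeSemigroup using (x∙yz≈y∙xz)
  open import Data.List using ([]; _∷_; map)
  open import Data.Product using (∃-syntax; _×_; _,_)
  open import Data.Sum using (inj₁; inj₂)
  open import Data.Empty using (⊥-elim)
  open import Relation.Nullary using (¬_; yes; no)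
  open import Relation.Binary.PropositionalEquality
  open import Function using (_$_)

  pow₂ : ℕ → ℤ
  pow₂ n = + (2 ^ n)

  pow₂-+ : ∀ m n → pow₂ (m ℕ.+ n) ≡ pow₂ m * pow₂ n
  pow₂-+ m n = trans (cong +_ (ℕP.^-distribˡ-+-* 2 m n)) (ℤP.pos-* (2 ^ m) (2 ^ n))

  pow₂-mono-∣ : ∀ {m n} → m ≤ n → pow₂ m ∣ pow₂ n
  pow₂-mono-∣ {m} m≤n with ℕP.m≤n⇒∃[o]m+o≡n m≤n
  ... | o , refl rewrite pow₂-+ m o = ∣m⇒∣m*n (pow₂ o) ∣-refl

  -- v₂ x ≥ g ⊖ e says v₂(x) ≥ g − e; the bound may be negative, so it is kept as a difference of naturals.
  record v₂_≥_⊖_ (x : ℤ) (g e : ℕ) : Set where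
    constructor v₂≥
    field pow₂-∣ : pow₂ g ∣ pow₂ e * x

  v₂≥-zero : ∀ g e → v₂ + 0 ≥ g ⊖ e
  v₂≥-zero g e = v₂≥ (divides (+ 0) (ℤP.*-zeroʳ (pow₂ e)))

  v₂≥-≤ : ∀ {g e} x → g ≤ e → v₂ x ≥ g ⊖ e
  v₂≥-≤ x g≤e = v₂≥ (∣m⇒∣m*n x (pow₂-mono-∣ g≤e))

  v₂≥-+ : ∀ {g e x y} → v₂ x ≥ g ⊖ e → v₂ y ≥ g ⊖ e → v₂ (x + y) ≥ g ⊖ e
  v₂≥-+ {g} {e} {x} {y} (v₂≥ hx) (v₂≥ hy) =
    v₂≥ (subst (pow₂ g ∣_) (sym (ℤP.*-distribˡ-+ (pow₂ e) x y)) (∣m∣n⇒∣m+n hx hy))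

  v₂≥-* : ∀ {a b c d x y} → v₂ x ≥ a ⊖ b → v₂ y ≥ c ⊖ d → v₂ (x * y) ≥ (a ℕ.+ c) ⊖ (b ℕ.+ d)
  v₂≥-* {a} {b} {c} {d} {x} {y} (v₂≥ hx) (v₂≥ hy) = v₂≥ $ begin
    pow₂ (a ℕ.+ c)                  ≡⟨ pow₂-+ a c ⟩
    pow₂ a * pow₂ c                 ∣⟨ *-monoˡ-∣ (pow₂ c) hx ⟩
    (pow₂ b * x) * pow₂ c           ∣⟨ *-monoʳ-∣ (pow₂ b * x) hy ⟩
    (pow₂ b * x) * (pow₂ d * y)     ≡⟨ interchange (pow₂ b) x (pow₂ d) y ⟩
    (pow₂ b * pow₂ d) * (x * y)     ≡⟨ cong (_* (x * y)) (pow₂-+ b d) ⟨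
    pow₂ (b ℕ.+ d) * (x * y)        ∎
    where open ∣-Reasoning

  v₂≥-double : ∀ {a b x} → v₂ x ≥ a ⊖ b → v₂ (x + x) ≥ suc a ⊖ b
  v₂≥-double {a} {b} {x} (v₂≥ h) = v₂≥ $ begin
    pow₂ (suc a)                   ≡⟨ ℤP.pos-* 2 (2 ^ a) ⟩
    + 2 * pow₂ a                   ∣⟨ *-monoʳ-∣ (+ 2) h ⟩
    + 2 * (pow₂ b * x)             ≡⟨ twice (pow₂ b * x) ⟩
    pow₂ b * x + pow₂ b * x        ≡⟨ ℤP.*-distribˡ-+ (pow₂ b) x x ⟨
    pow₂ b * (x + x)               ∎
    where
    open ∣-Reasoning
    twice : ∀ y → + 2 * y ≡ y + y
    twice y = trans (ℤP.*-distribʳ-+ y (+ 1) (+ 1)) (cong₂ _+_ (ℤP.*-identityˡ y) (ℤP.*-identityˡ y))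

  v₂≥-weaken : ∀ {a b g e x} → v₂ x ≥ a ⊖ b → g ℕ.+ b ≤ a ℕ.+ e → v₂ x ≥ g ⊖ e
  v₂≥-weaken {a} {b} {g} {e} {x} (v₂≥ h) le = v₂≥ $ *-cancelˡ-∣ (pow₂ b) {{ℕP.m^n≢0 2 b}} (begin
    pow₂ b * pow₂ g             ≡⟨ sym (pow₂-+ b g) ⟩
    pow₂ (b ℕ.+ g)              ∣⟨ pow₂-mono-∣ (subst (_≤ a ℕ.+ e) (ℕP.+-comm g b) le) ⟩
    pow₂ (a ℕ.+ e)              ≡⟨ pow₂-+ a e ⟩
    pow₂ a * pow₂ e             ∣⟨ *-monoˡ-∣ (pow₂ e) h ⟩
    (pow₂ b * x) * pow₂ e       ≡⟨ xy∙z≈x∙zy (pow₂ b) x (pow₂ e) ⟩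
    pow₂ b * (pow₂ e * x)       ∎)
    where open ∣-Reasoning

  coeff-⊕ : ∀ p q k → coeff (p ⊕ q) k ≡ coeff p k + coeff q k
  coeff-⊕ []      q       k       = sym (ℤP.+-identityˡ (coeff q k))
  coeff-⊕ (x ∷ p) []      k       = sym (ℤP.+-identityʳ (coeff (x ∷ p) k))
  coeff-⊕ (x ∷ p) (y ∷ q) zero    = refl
  coeff-⊕ (x ∷ p) (y ∷ q) (suc k) = coeff-⊕ p q k

  coeff-map-* : ∀ x q k → coeff (map (x *_) q) k ≡ x * coeff q k
  coeff-map-* x []      k       = sym (ℤP.*-zeroʳ x)
  coeff-map-* x (y ∷ q) zero    = refl
  coeff-map-* x (y ∷ q) (suc k) = coeff-map-* x q k

  coeff-∷-⊗ : ∀ x p q k → coeff ((x ∷ p) ⊗ q) k ≡ x * coeff q k + coeff (+ 0 ∷ p ⊗ q) k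
  coeff-∷-⊗ x p q k = trans (coeff-⊕ (map (x *_) q) (+ 0 ∷ p ⊗ q) k)
                            (cong (_+ coeff (+ 0 ∷ p ⊗ q) k) (coeff-map-* x q k))

  coeff-⊗-∷ : ∀ p y q k → coeff (p ⊗ (y ∷ q)) k ≡ coeff p k * y + coeff (+ 0 ∷ p ⊗ q) k
  coeff-⊗-∷ []      y q zero    = refl
  coeff-⊗-∷ []      y q (suc k) = refl
  coeff-⊗-∷ (x ∷ p) y q zero    = coeff-∷-⊗ x p (y ∷ q) zero
  coeff-⊗-∷ (x ∷ p) y q (suc k) = begin
    coeff ((x ∷ p) ⊗ (y ∷ q)) (suc k)                      ≡⟨ coeff-∷-⊗ x p (y ∷ q) (suc k) ⟩
    x * coeff q k + coeff (p ⊗ (y ∷ q)) k                   ≡⟨ cong (_+_ (x * coeff q k)) (coeff-⊗-∷ p y q k) ⟩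
    x * coeff q k + (coeff p k * y + coeff (+ 0 ∷ p ⊗ q) k) ≡⟨ x∙yz≈y∙xz (x * coeff q k) (coeff p k * y) _ ⟩
    coeff p k * y + (x * coeff q k + coeff (+ 0 ∷ p ⊗ q) k) ≡⟨ cong (_+_ (coeff p k * y)) (coeff-∷-⊗ x p q k) ⟨
    coeff p k * y + coeff ((x ∷ p) ⊗ q) k                  ∎
    where open ≡-Reasoning

  coeff-square-suc : ∀ x p k → coeff ((x ∷ p) ⊗ (x ∷ p)) (suc k)
                             ≡ (x * coeff p k + coeff p k * x) + coeff (+ 0 ∷ p ⊗ p) k
  coeff-square-suc x p k = begin
    coeff ((x ∷ p) ⊗ (x ∷ p)) (suc k)                        ≡⟨ coeff-∷-⊗ x p (x ∷ p) (suc k) ⟩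
    x * coeff p k + coeff (p ⊗ (x ∷ p)) k                     ≡⟨ cong (_+_ (x * coeff p k)) (coeff-⊗-∷ p x p k) ⟩
    x * coeff p k + (coeff p k * x + coeff (+ 0 ∷ p ⊗ p) k)   ≡⟨ ℤP.+-assoc (x * coeff p k) _ _ ⟨
    (x * coeff p k + coeff p k * x) + coeff (+ 0 ∷ p ⊗ p) k   ∎
    where open ≡-Reasoning

  square-coeff-closed : (Q : ℕ → ℤ → Set) →
    (∀ k → Q k (+ 0)) → (∀ {k x y} → Q k x → Q k y → Q k (x + y)) →
    ∀ p → (∀ i → Q (i ℕ.+ i) (coeff p i * coeff p i)) →
    (∀ i j → i < j → Q (i ℕ.+ j) (coeff p i * coeff p j + coeff p j * coeff p i)) →
    ∀ k → Q k (coeff (p ⊗ p) k)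
  square-coeff-closed Q Q-zero Q-+ []      diag pair k    = Q-zero k
  square-coeff-closed Q Q-zero Q-+ (x ∷ p) diag pair zero =
    subst (Q 0) (sym (coeff-∷-⊗ x p (x ∷ p) 0)) (Q-+ (diag 0) (Q-zero 0))
  square-coeff-closed Q Q-zero Q-+ (x ∷ p) diag pair (suc k) =
    subst (Q (suc k)) (sym (coeff-square-suc x p k)) (Q-+ (pair 0 (suc k) (s≤s z≤n)) (shifted k))
    where
    shifted : ∀ k → Q (suc k) (coeff (+ 0 ∷ p ⊗ p) k)
    shifted zero    = Q-zero 1
    shifted (suc k) = square-coeff-closed (λ k → Q (suc (suc k))) (λ k → Q-zero (suc (suc k))) Q-+ p
      (λ i → subst (λ t → Q (suc t) (coeff p i * coeff p i)) (ℕP.+-suc i i) (diag (suc i)))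
      (λ i j i<j → subst (λ t → Q (suc t) (coeff p i * coeff p j + coeff p j * coeff p i))
                          (ℕP.+-suc i j) (pair (suc i) (suc j) (s≤s i<j)))
      k

  n+n≡2*n : ∀ n → n ℕ.+ n ≡ 2 ℕ.* n
  n+n≡2*n n = cong (n ℕ.+_) (sym (ℕP.+-identityʳ n))

  -- Used with D = 2^(ℓ−1); the two nonzero values come from A(ℓ, D−1) = 2^(ℓ−2) and A(ℓ, D) = 1.
  deficit : ℕ → ℕ → ℕ → ℕ
  deficit D ℓ i with suc i ≟ D | i ≟ D
  ... | yes _ | _     = 1
  ... | no _  | yes _ = suc ℓ
  ... | no _  | no _  = 0

  deficit-pred : ∀ {D} ℓ {i} → suc i ≡ D → deficit D ℓ i ≡ 1
  deficit-pred {D} ℓ {i} si≡D with suc i ≟ D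
  ... | yes _    = refl
  ... | no si≢D  = ⊥-elim (si≢D si≡D)

  deficit-top : ∀ {D} ℓ {i} → i ≡ D → deficit D ℓ i ≡ suc ℓ
  deficit-top {D} ℓ {i} i≡D with suc i ≟ D | i ≟ D
  ... | yes si≡D | _      = ⊥-elim (ℕP.1+n≢n (trans si≡D (sym i≡D)))
  ... | no _     | yes _  = refl
  ... | no _     | no i≢D = ⊥-elim (i≢D i≡D)

  deficit-below : ∀ {D} ℓ {i} → suc (suc i) ≤ D → deficit D ℓ i ≡ 0
  deficit-below {D} ℓ {i} ssi≤D with suc i ≟ D | i ≟ D
  ... | yes refl | _      = ⊥-elim (ℕP.<-irrefl refl ssi≤D)
  ... | no _     | yes refl = ⊥-elim (ℕP.<-irrefl refl (ℕP.<-trans (ℕP.n<1+n i) ssi≤D))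
  ... | no _     | no _   = refl

  deficit-≤ : ∀ D ℓ i → deficit D ℓ i ≤ suc ℓ
  deficit-≤ D ℓ i with suc i ≟ D | i ≟ D
  ... | yes _ | _     = s≤s z≤n
  ... | no _  | yes _ = ℕP.≤-refl
  ... | no _  | no _  = z≤n

  deficit-diagonal : ∀ D {ℓ} i → 2 ≤ ℓ →
    deficit D ℓ i ℕ.+ deficit D ℓ i ≤ ℓ ℕ.+ deficit (2 ℕ.* D) (suc ℓ) (i ℕ.+ i)
  deficit-diagonal D {ℓ} i 2≤ℓ with suc i ≟ D | i ≟ D
  ... | yes _ | _      = ℕP.≤-trans 2≤ℓ (ℕP.m≤m+n ℓ _)
  ... | no _  | yes refl
    rewrite deficit-top (suc ℓ) (n+n≡2*n i) = ℕP.≤-reflexive (sym (ℕP.+-suc ℓ (suc ℓ)))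
  ... | no _  | no _   = z≤n

  deficit-pair : ∀ D ℓ {i j} → i < j →
    deficit D ℓ i ℕ.+ deficit D ℓ j ≤ suc ℓ ℕ.+ deficit (2 ℕ.* D) (suc ℓ) (i ℕ.+ j)
  deficit-pair D ℓ {i} {j} i<j with suc j ≟ D | j ≟ D
  ... | yes refl | _ rewrite deficit-below {D} ℓ (s≤s i<j) = s≤s z≤n
  ... | no _     | no _ rewrite ℕP.+-identityʳ (deficit D ℓ i) =
    ℕP.≤-trans (deficit-≤ D ℓ i) (ℕP.m≤m+n (suc ℓ) _)
  ... | no _     | yes refl with ℕP.m≤n⇒m<n∨m≡n i<j
  ...   | inj₂ refl rewrite deficit-pred ℓ {i} refl | deficit-pred (suc ℓ) (n+n≡2*n (suc i)) =
    ℕP.≤-reflexive (ℕP.+-comm 1 (suc ℓ))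
  ...   | inj₁ si<j rewrite deficit-below {j} ℓ si<j = ℕP.m≤m+n (suc ℓ) _

  bound-exponent : ℕ → ℕ → ℕ
  bound-exponent ℓ i = suc (2 ℕ.* i ℕ.+ ℓ)

  CoeffBound : ℕ → ℕ → Poly → Set
  CoeffBound D ℓ p = ∀ i → v₂ coeff p i ≥ bound-exponent ℓ i ⊖ (deficit D ℓ i ℕ.+ 2 ℕ.* D)

  diagonal-exponents : ∀ ℓ i E d d′ → d ℕ.+ d ≤ ℓ ℕ.+ d′ →
    suc (2 ℕ.* (i ℕ.+ i) ℕ.+ suc ℓ) ℕ.+ ((d ℕ.+ E) ℕ.+ (d ℕ.+ E))
      ≤ (suc (2 ℕ.* i ℕ.+ ℓ) ℕ.+ suc (2 ℕ.* i ℕ.+ ℓ)) ℕ.+ (d′ ℕ.+ 2 ℕ.* E)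
  diagonal-exponents ℓ i E d d′ le =
    subst₂ _≤_ (lhs ℓ i E d) (rhs ℓ i E d′) (ℕP.+-monoʳ-≤ (2 ℕ.+ ℓ ℕ.+ 4 ℕ.* i ℕ.+ 2 ℕ.* E) le)
    where
    lhs : ∀ ℓ i E d → (2 ℕ.+ ℓ ℕ.+ 4 ℕ.* i ℕ.+ 2 ℕ.* E) ℕ.+ (d ℕ.+ d)
                    ≡ suc (2 ℕ.* (i ℕ.+ i) ℕ.+ suc ℓ) ℕ.+ ((d ℕ.+ E) ℕ.+ (d ℕ.+ E))
    lhs = solve-∀
    rhs : ∀ ℓ i E d′ → (2 ℕ.+ ℓ ℕ.+ 4 ℕ.* i ℕ.+ 2 ℕ.* E) ℕ.+ (ℓ ℕ.+ d′)
                     ≡ (suc (2 ℕ.* i ℕ.+ ℓ) ℕ.+ suc (2 ℕ.* i ℕ.+ ℓ)) ℕ.+ (d′ ℕ.+ 2 ℕ.* E)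
    rhs = solve-∀

  pair-exponents : ∀ ℓ i j E d₁ d₂ d′ → d₁ ℕ.+ d₂ ≤ suc ℓ ℕ.+ d′ →
    suc (2 ℕ.* (i ℕ.+ j) ℕ.+ suc ℓ) ℕ.+ ((d₁ ℕ.+ E) ℕ.+ (d₂ ℕ.+ E))
      ≤ suc (suc (2 ℕ.* i ℕ.+ ℓ) ℕ.+ suc (2 ℕ.* j ℕ.+ ℓ)) ℕ.+ (d′ ℕ.+ 2 ℕ.* E)
  pair-exponents ℓ i j E d₁ d₂ d′ le =
    subst₂ _≤_ (lhs ℓ i j E d₁ d₂) (rhs ℓ i j E d′)
      (ℕP.+-monoʳ-≤ (2 ℕ.+ ℓ ℕ.+ 2 ℕ.* (i ℕ.+ j) ℕ.+ 2 ℕ.* E) le)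
    where
    lhs : ∀ ℓ i j E d₁ d₂ → (2 ℕ.+ ℓ ℕ.+ 2 ℕ.* (i ℕ.+ j) ℕ.+ 2 ℕ.* E) ℕ.+ (d₁ ℕ.+ d₂)
                         ≡ suc (2 ℕ.* (i ℕ.+ j) ℕ.+ suc ℓ) ℕ.+ ((d₁ ℕ.+ E) ℕ.+ (d₂ ℕ.+ E))
    lhs = solve-∀
    rhs : ∀ ℓ i j E d′ → (2 ℕ.+ ℓ ℕ.+ 2 ℕ.* (i ℕ.+ j) ℕ.+ 2 ℕ.* E) ℕ.+ (suc ℓ ℕ.+ d′)
                       ≡ suc (suc (2 ℕ.* i ℕ.+ ℓ) ℕ.+ suc (2 ℕ.* j ℕ.+ ℓ)) ℕ.+ (d′ ℕ.+ 2 ℕ.* E)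
    rhs = solve-∀

  coeff-bound-step : ∀ D ℓ p → 2 ≤ ℓ → 4 ℕ.+ ℓ ≤ 2 ℕ.* (2 ℕ.* D) →
    CoeffBound D ℓ p → CoeffBound (2 ℕ.* D) (suc ℓ) ((p ⊗ p) ⊕ cPoly)
  coeff-bound-step D ℓ p 2≤ℓ c-fits bound k rewrite coeff-⊕ (p ⊗ p) cPoly k =
    v₂≥-+ (square-coeff-closed Bound (λ k → v₂≥-zero _ _) v₂≥-+ p diagonal pair k) (c-term k)
    where
    Bound : ℕ → ℤ → Set
    Bound k x = v₂ x ≥ bound-exponent (suc ℓ) k ⊖ (deficit (2 ℕ.* D) (suc ℓ) k ℕ.+ 2 ℕ.* (2 ℕ.* D))

    diagonal : ∀ i → Bound (i ℕ.+ i) (coeff p i * coeff p i)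
    diagonal i = v₂≥-weaken (v₂≥-* (bound i) (bound i))
      (diagonal-exponents ℓ i (2 ℕ.* D) (deficit D ℓ i) (deficit (2 ℕ.* D) (suc ℓ) (i ℕ.+ i))
         (deficit-diagonal D i 2≤ℓ))

    pair : ∀ i j → i < j → Bound (i ℕ.+ j) (coeff p i * coeff p j + coeff p j * coeff p i)
    pair i j i<j rewrite ℤP.*-comm (coeff p j) (coeff p i) =
      v₂≥-weaken (v₂≥-double (v₂≥-* (bound i) (bound j)))
        (pair-exponents ℓ i j (2 ℕ.* D) (deficit D ℓ i) (deficit D ℓ j)
           (deficit (2 ℕ.* D) (suc ℓ) (i ℕ.+ j)) (deficit-pair D ℓ i<j))

    c-term : ∀ k → Bound k (coeff cPoly k)
    c-term 0             = v₂≥-zero _ _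
    c-term 1             = v₂≥-≤ (+ 1) (ℕP.≤-trans c-fits (ℕP.m≤n+m _ (deficit (2 ℕ.* D) (suc ℓ) 1)))
    c-term (suc (suc k)) = v₂≥-zero _ _

  6+n≤2^[3+n] : ∀ n → 6 ℕ.+ n ≤ 2 ^ (3 ℕ.+ n)
  6+n≤2^[3+n] zero    = ℕP.m≤m+n 6 2
  6+n≤2^[3+n] (suc n) = ℕP.≤-trans (s≤s (6+n≤2^[3+n] n))
    (subst (suc X ≤_) (n+n≡2*n X) (ℕP.+-monoˡ-≤ X (ℕP.m^n>0 2 (3 ℕ.+ n))))
    where X = 2 ^ (3 ℕ.+ n)

  coeff-bound : ∀ n → CoeffBound (2 ^ suc n) (2 ℕ.+ n) (a′ (suc n))
  coeff-bound zero    0                   = v₂≥-zero _ _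
  coeff-bound zero    1                   = v₂≥-≤ (+ 1) ℕP.≤-refl
  coeff-bound zero    2                   = v₂≥-≤ (+ 1) ℕP.≤-refl
  coeff-bound zero    (suc (suc (suc i))) = v₂≥-zero _ _
  coeff-bound (suc n) =
    coeff-bound-step (2 ^ suc n) (2 ℕ.+ n) (a′ (suc n)) (s≤s (s≤s z≤n)) (6+n≤2^[3+n] n) (coeff-bound n)

  2^_∥_ : ℕ → ℕ → Set
  2^ n ∥ m = 2 ^ n ℕ∣.∣ m × ¬ 2 ^ suc n ℕ∣.∣ m

  exact-power-of-two : ∀ m → m ≢ 0 → ∃[ n ] 2^ n ∥ m
  exact-power-of-two = <-rec _ go
    where
    go : ∀ m → (∀ {k} → k < m → k ≢ 0 → ∃[ n ] 2^ n ∥ k) → m ≢ 0 → ∃[ n ] 2^ n ∥ m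
    go m rec m≢0 with 2 ℕ∣.∣? m
    ... | no 2∤m = 0 , ℕ∣.1∣ m , 2∤m
    ... | yes (ℕ∣.divides q refl) with rec q<q*2 q≢0
      where
      q≢0 : q ≢ 0
      q≢0 q≡0 = m≢0 (cong (ℕ._* 2) q≡0)
      q<q*2 : q < q ℕ.* 2
      q<q*2 = ℕP.m<m*n q 2 ℕP.≤-refl
        where instance _ = ℕ.≢-nonZero q≢0
    ... | n , 2ⁿ∣q , 2ⁿ⁺¹∤q rewrite ℕP.*-comm q 2 =
      suc n , ℕ∣.*-monoʳ-∣ 2 2ⁿ∣q , λ 2ⁿ⁺²∣2q → 2ⁿ⁺¹∤q (ℕ∣.*-cancelˡ-∣ 2 2ⁿ⁺²∣2q)

  v₂≥⇒v₂-gt : ∀ {g e} x → v₂ x ≥ suc g ⊖ e → v₂-gt x (g ℤ.⊖ e)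
  v₂≥⇒v₂-gt {g} {e} x (v₂≥ h) with ∣ x ∣ ≟ 0
  ... | yes ∣x∣≡0 = inj₁ (ℤP.∣i∣≡0⇒i≡0 ∣x∣≡0)
  ... | no ∣x∣≢0 with exact-power-of-two ∣ x ∣ ∣x∣≢0
  ... | n , 2ⁿ∣x , 2ⁿ⁺¹∤x = inj₂ (n , 2ⁿ∣x , 2ⁿ⁺¹∤x , g⊖e<n)
    where
    2^[1+g]∣2^e*∣x∣ : 2 ^ suc g ℕ∣.∣ 2 ^ e ℕ.* ∣ x ∣
    2^[1+g]∣2^e*∣x∣ = subst (2 ^ suc g ℕ∣.∣_) (ℤP.abs-* (pow₂ e) x) (∣⇒∣ᵤ h)
    g<e+n : g < e ℕ.+ n
    g<e+n with suc g ℕP.≤? e ℕ.+ n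
    ... | yes g<e+n = g<e+n
    ... | no g≮e+n = ⊥-elim (2ⁿ⁺¹∤x (ℕ∣.*-cancelˡ-∣ (2 ^ e) {{ℕP.m^n≢0 2 e}}
            (subst (ℕ∣._∣ 2 ^ e ℕ.* ∣ x ∣) (ℕP.^-distribˡ-+-* 2 e (suc n))
              (ℕ∣.∣-trans (∣⇒∣ᵤ (pow₂-mono-∣ e+1+n≤1+g)) 2^[1+g]∣2^e*∣x∣))))
      where
      e+1+n≤1+g : e ℕ.+ suc n ≤ suc g
      e+1+n≤1+g = subst (_≤ suc g) (sym (ℕP.+-suc e n)) (ℕP.≰⇒> g≮e+n)
    g⊖e<n : g ℤ.⊖ e ℤ.< + n
    g⊖e<n = subst (g ℤ.⊖ e ℤ.<_) (trans (ℤP.⊖-≥ (ℕP.m≤m+n e n)) (cong +_ (ℕP.m+n∸m≡n e n)))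
                  (ℤP.⊖-monoˡ-< e g<e+n)

open TwoAdicBounds
open import Defs
open import Data.Nat using (ℕ; suc; _≤_; _∸_; _^_; _*_; z≤n; s≤s)
import Data.Nat as ℕ
import Data.Nat.Properties as ℕP
open import Data.Integer using (+_; _+_; _-_)
import Data.Integer as ℤ
import Data.Integer.Properties as ℤP
open import Relation.Binary.PropositionalEquality using (_≡_; sym; trans; cong; subst)

lemma8p1 : (ℓ i : ℕ) → 2 ≤ ℓ → i ≤ 2 ^ (ℓ ∸ 1) ∸ 2 →
    v₂-gt (A ℓ i) ((+ (2 * i) + + ℓ) - + (2 ^ ℓ))
lemma8p1 (suc (suc n)) i (s≤s (s≤s z≤n)) i≤D∸2 =
  subst (v₂-gt (A ℓ i)) exponent (v₂≥⇒v₂-gt (A ℓ i) bound)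
  where
  ℓ D : ℕ
  ℓ = suc (suc n)
  D = 2 ^ suc n
  2+i≤D : suc (suc i) ≤ D
  2+i≤D = subst (_≤ D) (ℕP.+-comm i 2) (ℕP.m≤o∸n⇒m+n≤o i (ℕP.^-monoʳ-≤ 2 {1} {suc n} (s≤s z≤n)) i≤D∸2)
  bound : v₂ A ℓ i ≥ suc (2 * i ℕ.+ ℓ) ⊖ (2 ^ ℓ)
  bound = subst (λ d → v₂ A ℓ i ≥ bound-exponent ℓ i ⊖ (d ℕ.+ 2 ^ ℓ))
                (deficit-below ℓ 2+i≤D) (coeff-bound n i)
  exponent : (2 * i ℕ.+ ℓ) ℤ.⊖ 2 ^ ℓ ≡ (+ (2 * i) + + ℓ) - + (2 ^ ℓ)
  exponent = trans (sym (ℤP.[+m]-[+n]≡m⊖n (2 * i ℕ.+ ℓ) (2 ^ ℓ)))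
                   (cong (_- + (2 ^ ℓ)) (ℤP.pos-+ (2 * i) ℓ))
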